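{- Consider representations of a positive integer as $h-k$ with $h,k$ harmonic numbers. Then: (i) The only such representations of $3$ are $4-1$, $6-3$, $9-6$, $12-9$, and $27-24$. (ii) The only such representations of $7$ are $8-1$, $9-2$, and $16-9$. (iii) If $p\ge 5$ and $2^p-1$ is prime, then the only such representation of $2^p-1$ is $2^p-1$ itself (i.e. $h=2^p$, $k=1$).
   Context: A harmonic number is a positive integer of the form $2^a3^b$ with $a,b\ge 0$ integers (so $1$ is harmonic). A Mersenne prime is a prime of the form $2^p-1$. -}

module Defs where

open import Data.Nat using (ℕ; _^_; _*_)
open import Data.Product using (∃₂)
open import Relation.Binary.PropositionalEquality using (_≡_)

Harmonic : ℕ → Set
Harmonic n = ∃₂ λ a b → n ≡ 2 ^ a * 3 ^ b

module Submission where

-- Two tools carry the whole argument.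
-- * Shape lemma: if N is prime to 6, then h = N + k forces k = 1, or
--   (h, k) = (3^b, 2^(c+1)), or (h, k) = (2^a, 3^(d+1)); otherwise 2 or 3 would
--   divide both h and k, hence N.
-- * Residue obstructions: the powers of 2 and of 3 take few values modulo a
--   well-chosen m (240 = 2^4·3·5, or 1632 = 2^5·3·17 for N = 7); an equation
--   x = y + z is impossible when no residue of x is a sum of residues of y and z.
-- Difference 1 and difference 7 then reduce to a finite table of small exponents.
-- Difference 3 is either 4 - 1, or both terms are multiples of 3, giving three times
-- a representation of 1. A Mersenne prime M = 2^p - 1 with p ≥ 5 is ≡ 31 or 127
-- (mod 240) (the residues 15 and 63 would make it a multiple of 3), and for such M
-- the residue obstruction leaves only M = 2^p - 1.

open import Defs
open import Data.Nat using (ℕ; _+_; _∸_; _^_; _≥_)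
open import Data.Nat.Primality using (Prime)
open import Data.Product using (_×_; _,_)
open import Data.Sum using (_⊎_)
open import Relation.Binary.PropositionalEquality using (_≡_)
open import Function.Bundles using (_⇔_)

open import Data.Nat using (zero; suc; s≤s; _*_; _%_; _/_; _<_; NonZero; ≢-nonZero⁻¹)
open import Data.Nat.Properties
  using (+-comm; +-identityʳ; +-suc; *-identityˡ; *-identityʳ; *-assoc; *-comm; *-distribˡ-+;
         *-cancelˡ-≡; +-cancelˡ-≡; m+n≡0⇒n≡0; suc-injective; m*n≢0; m^n≢0; m^n>0; m∸n+n≡m; <⇒≤)
open import Data.Nat.DivMod
  using (%-distribˡ-+; %-distribˡ-*; m%n%n≡m%n; m≡m%n+[m/n]*n; [m+kn]%n≡m%n; m<n⇒m%n≡m; m%n<n)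
open import Data.Nat.Divisibility
  using (_∣_; divides; _∣?_; _∣0; ∣-refl; m∣m*n; ∣m+n∣m⇒∣n; ∣m∣n⇒∣m+n; ∣n∣m%n⇒∣m; %-presˡ-∣)
open import Data.Nat.Primality using (prime⇒irreducible)
open import Data.List using (List; []; _∷_; map; cartesianProductWith)
open import Data.List.Relation.Unary.All as All using (All; all?)
open import Data.List.Relation.Unary.Any using (here; there)
open import Data.List.Membership.Propositional using (_∈_; _∉_)
open import Data.List.Membership.Propositional.Properties using (∈-cartesianProductWith⁺)
open import Data.List.Membership.DecPropositional Data.Nat._≟_ using (_∈?_)
open import Data.Sum using (inj₁; inj₂)
open import Data.Empty using (⊥; ⊥-elim)
open import Relation.Nullary using (¬_; Dec; ¬?)
open import Relation.Nullary.Decidable using (True; toWitness; from-no)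
open import Relation.Binary.PropositionalEquality using (_≢_; refl; sym; cong; subst; subst₂; module ≡-Reasoning)
open import Function.Bundles using (mk⇔)

*-%-absorb : ∀ x y m .{{_ : NonZero m}} → x * (y % m) % m ≡ x * y % m
*-%-absorb x y m = begin
  x * (y % m) % m             ≡⟨ %-distribˡ-* x (y % m) m ⟩
  (x % m) * (y % m % m) % m   ≡⟨ cong (λ t → (x % m) * t % m) (m%n%n≡m%n y m) ⟩
  (x % m) * (y % m) % m       ≡⟨ %-distribˡ-* x y m ⟨
  x * y % m                   ∎
  where open ≡-Reasoning

powers-in-orbit : ∀ x m .{{_ : NonZero m}} {L : List ℕ} j → x ^ j % m ∈ L →
                  {True (all? (λ r → x * r % m ∈? L) L)} → ∀ n → x ^ (j + n) % m ∈ L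
powers-in-orbit x m j start zero rewrite +-identityʳ j = start
powers-in-orbit x m {L} j start {closed} (suc n) rewrite +-suc j n =
  subst (_∈ L) (*-%-absorb x (x ^ (j + n)) m)
        (All.lookup (toWitness closed) (powers-in-orbit x m j start {closed} n))

pow2-mod240 : ∀ n → 2 ^ n % 240 ∈ 1 ∷ 2 ∷ 4 ∷ 8 ∷ 16 ∷ 32 ∷ 64 ∷ 128 ∷ []
pow2-mod240 = powers-in-orbit 2 240 0 (here refl)

pow2¹-mod240 : ∀ n → 2 ^ (1 + n) % 240 ∈ 2 ∷ 4 ∷ 8 ∷ 16 ∷ 32 ∷ 64 ∷ 128 ∷ []
pow2¹-mod240 = powers-in-orbit 2 240 1 (here refl)

pow2⁴-mod240 : ∀ n → 2 ^ (4 + n) % 240 ∈ 16 ∷ 32 ∷ 64 ∷ 128 ∷ []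
pow2⁴-mod240 = powers-in-orbit 2 240 4 (here refl)

pow3-mod240 : ∀ n → 3 ^ n % 240 ∈ 1 ∷ 3 ∷ 9 ∷ 27 ∷ 81 ∷ []
pow3-mod240 = powers-in-orbit 3 240 0 (here refl)

pow3¹-mod240 : ∀ n → 3 ^ (1 + n) % 240 ∈ 3 ∷ 9 ∷ 27 ∷ 81 ∷ []
pow3¹-mod240 = powers-in-orbit 3 240 1 (here refl)

-- Modulo 1632 = 2^5·3·17, needed to rule out 2^(5+a) = 7 + 3^(1+d).
pow2⁵-mod1632 : ∀ n → 2 ^ (5 + n) % 1632 ∈ 32 ∷ 64 ∷ 128 ∷ 256 ∷ 512 ∷ 1024 ∷ 416 ∷ 832 ∷ []
pow2⁵-mod1632 = powers-in-orbit 2 1632 5 (here refl)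

pow3¹-mod1632 : ∀ n → 3 ^ (1 + n) % 1632 ∈
  3 ∷ 9 ∷ 27 ∷ 81 ∷ 243 ∷ 729 ∷ 555 ∷ 33 ∷ 99 ∷ 297 ∷ 891 ∷ 1041 ∷ 1491 ∷ 1209 ∷ 363 ∷ 1089 ∷ []
pow3¹-mod1632 = powers-in-orbit 3 1632 1 (here refl)

only : ∀ {r : ℕ} → r ∈ r ∷ []
only = here refl

Disjoint : List ℕ → List ℕ → Set
Disjoint A B = All (_∉ B) A

disjoint? : (A B : List ℕ) → Dec (Disjoint A B)
disjoint? A B = all? (λ a → ¬? (a ∈? B)) A

sumResidues : (m : ℕ) .{{_ : NonZero m}} → List ℕ → List ℕ → List ℕ
sumResidues m = cartesianProductWith (λ b c → (b + c) % m)

sum-residue : ∀ m .{{_ : NonZero m}} {B C y z} → y % m ∈ B → z % m ∈ C →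
              (y + z) % m ∈ sumResidues m B C
sum-residue m {y = y} {z} y∈B z∈C =
  subst (_∈ _) (sym (%-distribˡ-+ y z m)) (∈-cartesianProductWith⁺ (λ b c → (b + c) % m) y∈B z∈C)

residue-obstruction : ∀ m .{{_ : NonZero m}} y z {A B C x} → x % m ∈ A → y % m ∈ B → z % m ∈ C →
                      {True (disjoint? A (sumResidues m B C))} → x ≢ y + z
residue-obstruction m y z x∈A y∈B z∈C {disjoint} refl =
  All.lookup (toWitness disjoint) x∈A (sum-residue m y∈B z∈C)

not-divisible-by-residue : ∀ {d m n} .{{_ : NonZero m}} {L} → d ∣ m → n % m ∈ L →
                           {True (all? (λ r → ¬? (d ∣? r)) L)} → ¬ d ∣ n
not-divisible-by-residue d∣m n∈L {none} d∣n =
  All.lookup (toWitness none) n∈L (%-presˡ-∣ d∣n d∣m)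

pred-residue : ∀ n m {r} .{{_ : NonZero m}} → n % m ≡ suc r → (n ∸ 1) % m ≡ r
pred-residue n m {r} e = begin
  (n ∸ 1) % m                     ≡⟨ cong (λ t → (t ∸ 1) % m) (m≡m%n+[m/n]*n n m) ⟩
  (n % m + n / m * m ∸ 1) % m     ≡⟨ cong (λ t → (t + n / m * m ∸ 1) % m) e ⟩
  (r + n / m * m) % m             ≡⟨ [m+kn]%n≡m%n r (n / m) m ⟩
  r % m                           ≡⟨ m<n⇒m%n≡m (<⇒≤ (subst (_< m) e (m%n<n n m))) ⟩
  r                               ∎
  where open ≡-Reasoning

pred-residues : ∀ n m .{{_ : NonZero m}} {L} → n % m ∈ map suc L → (n ∸ 1) % m ∈ L
pred-residues n m {_ ∷ _} (here e)  = here (pred-residue n m e)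
pred-residues n m {_ ∷ _} (there i) = there (pred-residues n m i)

harmonic≢0 : ∀ {n} → Harmonic n → n ≢ 0
harmonic≢0 (a , b , refl) = ≢-nonZero⁻¹ _ {{m*n≢0 (2 ^ a) (3 ^ b) {{m^n≢0 2 a}} {{m^n≢0 3 b}}}}

harmonic-factor-3 : ∀ a b → 2 ^ a * 3 ^ suc b ≡ 3 * (2 ^ a * 3 ^ b)
harmonic-factor-3 a b = begin
  2 ^ a * (3 * 3 ^ b)   ≡⟨ *-assoc (2 ^ a) 3 (3 ^ b) ⟨
  2 ^ a * 3 * 3 ^ b     ≡⟨ cong (_* 3 ^ b) (*-comm (2 ^ a) 3) ⟩
  3 * 2 ^ a * 3 ^ b     ≡⟨ *-assoc 3 (2 ^ a) (3 ^ b) ⟩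
  3 * (2 ^ a * 3 ^ b)   ∎
  where open ≡-Reasoning

3∣harmonic : ∀ a b → 3 ∣ 2 ^ a * 3 ^ suc b
3∣harmonic a b = subst (3 ∣_) (sym (harmonic-factor-3 a b)) (m∣m*n (2 ^ a * 3 ^ b))

2∣harmonic : ∀ a b → 2 ∣ 2 ^ suc a * 3 ^ b
2∣harmonic a b = subst (2 ∣_) (sym (*-assoc 2 (2 ^ a) (3 ^ b))) (m∣m*n (2 ^ a * 3 ^ b))

3∤2ⁿ : ∀ n → ¬ 3 ∣ 2 ^ n
3∤2ⁿ n = not-divisible-by-residue ∣-refl (powers-in-orbit 2 3 {1 ∷ 2 ∷ []} 0 (here refl) n)

common-divisor : ∀ {d h k N} → d ∣ h → d ∣ k → h ≡ N + k → d ∣ N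
common-divisor {d} {k = k} {N} d∣h d∣k refl =
  ∣m+n∣m⇒∣n (subst (d ∣_) (+-comm N k) d∣h) d∣k

data CoprimeShape : ℕ → ℕ → Set where
  k≡1  : ∀ h → CoprimeShape h 1
  h≡3ᵇ : ∀ b c → CoprimeShape (3 ^ b) (2 ^ suc c)
  h≡2ᵃ : ∀ a d → CoprimeShape (2 ^ a) (3 ^ suc d)

-- Shape lemma: 2 (resp. 3) cannot divide both h and k, and h = 1 is too small.
coprime-shape : ∀ {N h k} → ¬ 2 ∣ N → ¬ 3 ∣ N → Harmonic h → Harmonic k → h ≡ N + k →
                CoprimeShape h k
coprime-shape _ _ _ (0 , 0 , refl) _ = k≡1 _
coprime-shape {zero} 2∤N _ (0 , 0 , refl) _ _ = ⊥-elim (2∤N (2 ∣0))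
coprime-shape {suc N} _ _ (0 , 0 , refl) hk eq =
  ⊥-elim (harmonic≢0 hk (m+n≡0⇒n≡0 N (suc-injective (sym eq))))
coprime-shape 2∤N _ (suc a , b , refl) (suc c , d , refl) eq =
  ⊥-elim (2∤N (common-divisor (2∣harmonic a b) (2∣harmonic c d) eq))
coprime-shape _ 3∤N (a , suc b , refl) (c , suc d , refl) eq =
  ⊥-elim (3∤N (common-divisor (3∣harmonic a b) (3∣harmonic c d) eq))
coprime-shape _ _ (0 , suc b , refl) (suc c , 0 , refl) _ =
  subst₂ CoprimeShape (sym (*-identityˡ _)) (sym (*-identityʳ _)) (h≡3ᵇ (suc b) c)
coprime-shape _ _ (suc a , 0 , refl) (0 , suc d , refl) _ =
  subst₂ CoprimeShape (sym (*-identityʳ _)) (sym (*-identityˡ _)) (h≡2ᵃ (suc a) d)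

Diff1 : ℕ → ℕ → Set
Diff1 h k = (h , k) ≡ (2 , 1) ⊎ (h , k) ≡ (3 , 2) ⊎ (h , k) ≡ (4 , 3) ⊎ (h , k) ≡ (9 , 8)

difference-1 : ∀ {h k} → Harmonic h → Harmonic k → h ≡ 1 + k → Diff1 h k
difference-1 hh hk eq = classify (coprime-shape (from-no (2 ∣? 1)) (from-no (3 ∣? 1)) hh hk eq) eq
  where
  classify : ∀ {h k} → CoprimeShape h k → h ≡ 1 + k → Diff1 h k
  classify (k≡1 _) refl = inj₁ refl
  classify (h≡3ᵇ b 0) eq = inj₂ (inj₁ (cong (_, 2) eq))
  classify (h≡3ᵇ b 1) eq = ⊥-elim (residue-obstruction 240 1 4 (pow3-mod240 b) only only eq)
  classify (h≡3ᵇ b 2) eq = inj₂ (inj₂ (inj₂ (cong (_, 8) eq)))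
  classify (h≡3ᵇ b (suc (suc (suc c)))) eq =
    ⊥-elim (residue-obstruction 240 1 (2 ^ (4 + c)) (pow3-mod240 b) only (pow2⁴-mod240 c) eq)
  classify (h≡2ᵃ 0 d) eq = ⊥-elim (residue-obstruction 240 1 (3 ^ (1 + d)) only only (pow3¹-mod240 d) eq)
  classify (h≡2ᵃ 1 d) eq = ⊥-elim (residue-obstruction 240 1 (3 ^ (1 + d)) only only (pow3¹-mod240 d) eq)
  classify (h≡2ᵃ 2 d) eq = inj₂ (inj₂ (inj₁ (cong (4 ,_) (sym (suc-injective eq)))))
  classify (h≡2ᵃ 3 d) eq = ⊥-elim (residue-obstruction 240 1 (3 ^ (1 + d)) only only (pow3¹-mod240 d) eq)
  classify (h≡2ᵃ (suc (suc (suc (suc a)))) d) eq =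
    ⊥-elim (residue-obstruction 240 1 (3 ^ (1 + d)) (pow2⁴-mod240 a) only (pow3¹-mod240 d) eq)

Diff3 : ℕ → ℕ → Set
Diff3 h k = (h , k) ≡ (4 , 1) ⊎ (h , k) ≡ (6 , 3) ⊎ (h , k) ≡ (9 , 6)
          ⊎ (h , k) ≡ (12 , 9) ⊎ (h , k) ≡ (27 , 24)

scale-by-3 : ∀ {h k h′ k′} → h ≡ 3 * h′ → k ≡ 3 * k′ → Diff1 h′ k′ → Diff3 h k
scale-by-3 refl refl (inj₁ refl)                 = inj₂ (inj₁ refl)
scale-by-3 refl refl (inj₂ (inj₁ refl))          = inj₂ (inj₂ (inj₁ refl))
scale-by-3 refl refl (inj₂ (inj₂ (inj₁ refl)))   = inj₂ (inj₂ (inj₂ (inj₁ refl)))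
scale-by-3 refl refl (inj₂ (inj₂ (inj₂ refl)))   = inj₂ (inj₂ (inj₂ (inj₂ refl)))

-- Apart from 4 - 1, both terms are multiples of 3 (if 3 divided exactly one of
-- them it would divide a power of 2), and dividing by 3 gives a representation of 1.
difference-3 : ∀ {h k} → Harmonic h → Harmonic k → h ≡ 3 + k → Diff3 h k
difference-3 _ (0 , 0 , refl) refl = inj₁ refl
difference-3 (0 , 0 , refl) _ ()
difference-3 (suc a , b , refl) (suc c , d , refl) eq =
  ⊥-elim (from-no (2 ∣? 3) (common-divisor (2∣harmonic a b) (2∣harmonic c d) eq))
difference-3 (a , suc b , refl) (c , 0 , refl) eq =
  ⊥-elim (3∤2ⁿ c (subst (3 ∣_) (*-identityʳ (2 ^ c))
    (∣m+n∣m⇒∣n (subst (3 ∣_) eq (3∣harmonic a b)) ∣-refl)))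
difference-3 (a , 0 , refl) (c , suc d , refl) eq =
  ⊥-elim (3∤2ⁿ a (subst (3 ∣_) (*-identityʳ (2 ^ a))
    (subst (3 ∣_) (sym eq) (∣m∣n⇒∣m+n ∣-refl (3∣harmonic c d)))))
difference-3 (a , suc b , refl) (c , suc d , refl) eq =
  scale-by-3 (harmonic-factor-3 a b) (harmonic-factor-3 c d)
    (difference-1 (a , b , refl) (c , d , refl) (*-cancelˡ-≡ h′ (1 + k′) 3 thrice))
  where
  h′ = 2 ^ a * 3 ^ b
  k′ = 2 ^ c * 3 ^ d
  thrice : 3 * h′ ≡ 3 * (1 + k′)
  thrice = begin
    3 * h′                 ≡⟨ harmonic-factor-3 a b ⟨
    2 ^ a * 3 ^ suc b      ≡⟨ eq ⟩
    3 + 2 ^ c * 3 ^ suc d  ≡⟨ cong (3 +_) (harmonic-factor-3 c d) ⟩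
    3 + 3 * k′             ≡⟨ *-distribˡ-+ 3 1 k′ ⟨
    3 * (1 + k′)           ∎
    where open ≡-Reasoning

Diff7 : ℕ → ℕ → Set
Diff7 h k = (h , k) ≡ (8 , 1) ⊎ (h , k) ≡ (9 , 2) ⊎ (h , k) ≡ (16 , 9)

difference-7 : ∀ {h k} → Harmonic h → Harmonic k → h ≡ 7 + k → Diff7 h k
difference-7 hh hk eq = classify (coprime-shape (from-no (2 ∣? 7)) (from-no (3 ∣? 7)) hh hk eq) eq
  where
  classify : ∀ {h k} → CoprimeShape h k → h ≡ 7 + k → Diff7 h k
  classify (k≡1 _) refl = inj₁ refl
  classify (h≡3ᵇ b 0) eq = inj₂ (inj₁ (cong (_, 2) eq))
  classify (h≡3ᵇ b 1) eq = ⊥-elim (residue-obstruction 240 7 4 (pow3-mod240 b) only only eq)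
  classify (h≡3ᵇ b 2) eq = ⊥-elim (residue-obstruction 240 7 8 (pow3-mod240 b) only only eq)
  classify (h≡3ᵇ b (suc (suc (suc c)))) eq =
    ⊥-elim (residue-obstruction 240 7 (2 ^ (4 + c)) (pow3-mod240 b) only (pow2⁴-mod240 c) eq)
  classify (h≡2ᵃ 0 d) ()
  classify (h≡2ᵃ 1 d) ()
  classify (h≡2ᵃ 2 d) ()
  classify (h≡2ᵃ 3 d) eq = ⊥-elim (residue-obstruction 240 7 (3 ^ (1 + d)) only only (pow3¹-mod240 d) eq)
  classify (h≡2ᵃ 4 d) eq = inj₂ (inj₂ (cong (16 ,_) (sym (+-cancelˡ-≡ 7 _ _ eq))))
  classify (h≡2ᵃ (suc (suc (suc (suc (suc a))))) d) eq =
    ⊥-elim (residue-obstruction 1632 7 (3 ^ (1 + d)) (pow2⁵-mod1632 a) only (pow3¹-mod1632 d) eq)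

mersenne-residue : ∀ p → p ≥ 4 → (2 ^ p ∸ 1) % 240 ∈ 15 ∷ 31 ∷ 63 ∷ 127 ∷ []
mersenne-residue (suc (suc (suc (suc n)))) (s≤s (s≤s (s≤s (s≤s _)))) =
  pred-residues (2 ^ (4 + n)) 240 (pow2⁴-mod240 n)

-- A prime M ≡ r (mod 240) with 3 ∣ r is divisible by 3, so M = 3 and r = 3.
prime-residue-not-multiple-of-3 : ∀ {M r} → Prime M → M % 240 ≡ r → 3 ∣ r → r ≢ 3 → ⊥
prime-residue-not-multiple-of-3 M-prime e 3∣r r≢3
  with prime⇒irreducible M-prime (∣n∣m%n⇒∣m (divides 80 refl) (subst (3 ∣_) (sym e) 3∣r))
... | inj₁ ()
... | inj₂ refl = r≢3 (sym e)

prime-residue : ∀ {M} → Prime M → M % 240 ∈ 15 ∷ 31 ∷ 63 ∷ 127 ∷ [] → M % 240 ∈ 31 ∷ 127 ∷ []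
prime-residue M-prime (here e) =
  ⊥-elim (prime-residue-not-multiple-of-3 M-prime e (divides 5 refl) (λ ()))
prime-residue M-prime (there (here e)) = here e
prime-residue M-prime (there (there (here e))) =
  ⊥-elim (prime-residue-not-multiple-of-3 M-prime e (divides 21 refl) (λ ()))
prime-residue M-prime (there (there (there (here e)))) = there (here e)

-- If M ≡ 31 or 127 (mod 240), the only representation of M is (M + 1) - 1: such M
-- is prime to 6, and both remaining shapes are excluded modulo 240.
difference-31-127 : ∀ {M h k} → M % 240 ∈ 31 ∷ 127 ∷ [] → Harmonic h → Harmonic k → h ≡ M + k →
                    (h , k) ≡ (M + 1 , 1)
difference-31-127 {M} M∈ hh hk eq = classify (coprime-shape 2∤M 3∤M hh hk eq) eq
  where
  2∤M : ¬ 2 ∣ M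
  2∤M = not-divisible-by-residue (divides 120 refl) M∈
  3∤M : ¬ 3 ∣ M
  3∤M = not-divisible-by-residue (divides 80 refl) M∈
  classify : ∀ {h k} → CoprimeShape h k → h ≡ M + k → (h , k) ≡ (M + 1 , 1)
  classify (k≡1 _) refl = refl
  classify (h≡3ᵇ b c) eq =
    ⊥-elim (residue-obstruction 240 M (2 ^ (1 + c)) (pow3-mod240 b) M∈ (pow2¹-mod240 c) eq)
  classify (h≡2ᵃ a d) eq =
    ⊥-elim (residue-obstruction 240 M (3 ^ (1 + d)) (pow2-mod240 a) M∈ (pow3¹-mod240 d) eq)

diff3-sound : ∀ {h k} → Diff3 h k → Harmonic h × Harmonic k × h ≡ 3 + k
diff3-sound (inj₁ refl)                         = (2 , 0 , refl) , (0 , 0 , refl) , refl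
diff3-sound (inj₂ (inj₁ refl))                  = (1 , 1 , refl) , (0 , 1 , refl) , refl
diff3-sound (inj₂ (inj₂ (inj₁ refl)))           = (0 , 2 , refl) , (1 , 1 , refl) , refl
diff3-sound (inj₂ (inj₂ (inj₂ (inj₁ refl))))    = (2 , 1 , refl) , (0 , 2 , refl) , refl
diff3-sound (inj₂ (inj₂ (inj₂ (inj₂ refl))))    = (0 , 3 , refl) , (3 , 1 , refl) , refl

diff7-sound : ∀ {h k} → Diff7 h k → Harmonic h × Harmonic k × h ≡ 7 + k
diff7-sound (inj₁ refl)        = (3 , 0 , refl) , (0 , 0 , refl) , refl
diff7-sound (inj₂ (inj₁ refl)) = (0 , 2 , refl) , (1 , 0 , refl) , refl
diff7-sound (inj₂ (inj₂ refl)) = (4 , 0 , refl) , (0 , 2 , refl) , refl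

-- Adding 1 back to 2^p - 1, which is a true subtraction since 2^p ≥ 1.
2ᵖ-1+1 : ∀ p → (2 ^ p ∸ 1) + 1 ≡ 2 ^ p
2ᵖ-1+1 p = m∸n+n≡m (m^n>0 2 p)

theorem3p1 :
    ((h k : ℕ) → (Harmonic h × Harmonic k × h ≡ 3 + k)
      ⇔ ((h , k) ≡ (4 , 1) ⊎ (h , k) ≡ (6 , 3) ⊎ (h , k) ≡ (9 , 6)
          ⊎ (h , k) ≡ (12 , 9) ⊎ (h , k) ≡ (27 , 24)))
    × ((h k : ℕ) → (Harmonic h × Harmonic k × h ≡ 7 + k)
      ⇔ ((h , k) ≡ (8 , 1) ⊎ (h , k) ≡ (9 , 2) ⊎ (h , k) ≡ (16 , 9)))
    × ((p : ℕ) → p ≥ 5 → Prime (2 ^ p ∸ 1) → (h k : ℕ)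
      → (Harmonic h × Harmonic k × h ≡ (2 ^ p ∸ 1) + k)
        ⇔ ((h , k) ≡ (2 ^ p , 1)))
theorem3p1 =
    (λ h k → mk⇔ (λ (hh , hk , eq) → difference-3 hh hk eq) diff3-sound)
  , (λ h k → mk⇔ (λ (hh , hk , eq) → difference-7 hh hk eq) diff7-sound)
  , λ p p≥5 M-prime h k → mk⇔
      (λ (hh , hk , eq) → subst (λ n → (h , k) ≡ (n , 1)) (2ᵖ-1+1 p)
         (difference-31-127 (prime-residue M-prime (mersenne-residue p (<⇒≤ p≥5))) hh hk eq))
      (λ { refl → (p , 0 , sym (*-identityʳ (2 ^ p))) , (0 , 0 , refl) , sym (2ᵖ-1+1 p) })
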